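{- For $n\geq 2$, let $\mathrm{Dic}_n=\langle a,b,c\mid a^n=b^2=c^2=abc\rangle$ be the dicyclic group of order $4n$. Then Player 1 has a winning strategy for $\texttt{RAV}(\mathrm{Dic}_n,\{a,b,c\})$.
   Context: This presentation is isomorphic to $\langle a,x\mid a^{2n}=e,\ x^2=a^n,\ x^{ -1}ax=a^{ -1}\rangle$ via $a\mapsto a$, $b\mapsto x^{ -1}$, $c\mapsto ax^{ -1}$. Game $\texttt{RAV}(G,S)$: $G$ is a finite group and $S$ a generating set with $e\notin S$. Two players alternate turns, Player 1 first, starting from the empty word $w_0$. On turn $n$ the current player chooses $s_n\in S\cup S^{ -1}$, subject to $s_n\neq s_{n-1}^{ -1}$ when $n>1$, and forms $w_n=w_{n-1}s_n$. If $w_n$ represents the same element of $G$ as some $w_k$ with $0\le k<n$, the player who formed $w_n$ loses. If a player has no legal move, that player loses. -}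

module Defs where

open import Data.Nat using (ℕ)
open import Data.Integer using (ℤ; +_; -_; _+_; _-_; 0ℤ; 1ℤ)
open import Data.Integer.Divisibility using (_∣_)
open import Data.Bool using (Bool; true; false; _xor_; _∧_; if_then_else_)
open import Data.Product using (_×_; _,_)
open import Data.List using (List; []; _∷_)
open import Data.List.Relation.Unary.Any using (Any)
open import Data.Empty using (⊥)
open import Data.Unit using (⊤)
open import Relation.Nullary using (¬_)
open import Relation.Binary.PropositionalEquality using (_≡_)

-- Concrete model of Dic_n via the isomorphic presentation
--   ⟨ a , x ∣ a^(2n) = e , x^2 = a^n , x⁻¹ a x = a⁻¹ ⟩.
-- An element (k , j) stands for a^k x^j  (k : ℤ, j : Bool with true = x^1).
module Dic (n : ℕ) where

  Elt : Set
  Elt = ℤ × Bool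

  _≈_ : Elt → Elt → Set
  (k , i) ≈ (l , j) = (i ≡ j) × (+ (2 ℕ* n) ∣ (k - l))
    where open import Data.Nat renaming (_*_ to _ℕ*_)

  e : Elt
  e = (0ℤ , false)

  -- (a^k x^i)(a^l x^j) = a^(k ± l + [i∧j]·n) x^(i xor j)
  _·_ : Elt → Elt → Elt
  (k , i) · (l , j) =
    ( k + (if i then - l else l) + (if i ∧ j then + n else 0ℤ) , i xor j )

  inv : Elt → Elt
  inv (k , false) = (- k , false)
  inv (k , true)  = (k + + n , true)

  x : Elt
  x = (0ℤ , true)

  genA genB genC : Elt
  genA = (1ℤ , false)
  genB = inv x
  genC = genA · inv x

data Gen : Set where
  a b c : Gen

data Sign : Set where
  pos neg : Sign

Move : Set
Move = Gen × Sign

-- History of moves, MOST RECENT FIRST: s_m ∷ ... ∷ s_1 ∷ [].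
History : Set
History = List Move

module RAVDic (n : ℕ) where
  open Dic n public

  genElt : Gen → Elt
  genElt a = genA
  genElt b = genB
  genElt c = genC

  moveElt : Move → Elt
  moveElt (s , pos) = genElt s
  moveElt (s , neg) = inv (genElt s)

  value : History → Elt
  value []      = e
  value (s ∷ h) = value h · moveElt s

  visited : History → List Elt
  visited []      = e ∷ []
  visited (s ∷ h) = value (s ∷ h) ∷ visited h

  Legal : History → Move → Set
  Legal []      s = ⊤
  Legal (t ∷ h) s = ¬ (moveElt s ≈ inv (moveElt t))

  -- playing s does not revisit an element (otherwise the mover loses at once)
  Fresh : History → Move → Set
  Fresh h s = ¬ Any (λ g → (value h · moveElt s) ≈ g) (visited h)

  -- Lose h : the player about to move at history h loses against best play,
  --          i.e. every legal non-revisiting move leads to a position that is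
  --          a win for the opponent (moves that revisit lose immediately, and
  --          having no legal move also loses).
  -- Inductive, so wins are forced in finitely many moves.
  data Win  (h : History) : Set
  data Lose (h : History) : Set

  data Win h where
    win : (s : Move) → Legal h s → Fresh h s → Lose (s ∷ h) → Win h

  data Lose h where
    lose : ((s : Move) → Legal h s → Fresh h s → Win (s ∷ h)) → Lose h

  Player1Wins : Set
  Player1Wins = Win []

{-# OPTIONS --safe #-}
-- The 4n elements of Dic_n fall into the 2n pairs {a^k, a^k x}, and Player 1
-- can always move from one element of a pair to the other: a^k b⁻¹ = a^k x and
-- a^k x b = a^k.  Player 1 opens with b⁻¹, and afterwards answers every move
-- of Player 2 to a new element g by moving to the partner of g.  The set of
-- visited elements is then always a union of pairs, so the partner of a fresh
-- g is fresh as well; the answer is never an immediate backtrack, since that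
-- would revisit the previous element.  Player 1 thus always has a move, and as
-- the group is finite Player 2 eventually has none.
module Submission where

open import Defs
open import Data.Bool using (true; false; not)
open import Data.Bool.Properties using (not-involutive; not-¬)
open import Data.Fin using (Fin; zero; suc; fromℕ<; join; splitAt)
open import Data.Fin.Properties using (injective⇒≤; fromℕ<-injective; splitAt-join)
open import Data.Integer using (ℤ; +_; -_; _+_; _-_; _*_; 0ℤ)
open import Data.Integer.DivMod using (_%ℕ_; _/ℕ_; a≡a%ℕn+[a/ℕn]*n; n%ℕd<d)
open import Data.Integer.Divisibility using (_∣_)
import Data.Integer.Divisibility.Signed as Signed
open import Data.Integer.Properties
  using (+-inverseʳ; ∣-i∣≡∣i∣; ∣i-j∣≡∣j-i∣; +-minus-telescope; pos-+)
import Data.Integer.Tactic.RingSolver as ℤ-Solver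
open import Data.List using (List; []; _∷_; length; lookup)
open import Data.List.Membership.Propositional.Properties using (∈-lookup)
import Data.List.Membership.Setoid as SetoidMembership
import Data.List.Membership.Setoid.Properties as SetoidMembershipProperties
import Data.List.Relation.Unary.All as All
open import Data.List.Relation.Unary.Any using (here; there)
import Data.List.Relation.Unary.Unique.Setoid as SetoidUnique
open import Data.Nat using (ℕ; zero; suc; _≤_; NonZero) renaming (_+_ to _+ℕ_; _*_ to _*ℕ_)
import Data.Nat.Divisibility as ℕ
open import Data.Nat.Properties using (m*n≢0; m≤m+n; +-identityʳ; <⇒≱)
import Data.Nat.Tactic.RingSolver as ℕ-Solver
open import Data.Product using (_×_; _,_)
open import Data.Sum using (_⊎_; inj₁; inj₂)
open import Data.Sum.Properties using (inj₁-injective; inj₂-injective)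
open import Data.Unit using (tt)
open import Function.Definitions using (Injective)
open import Level using (0ℓ)
open import Relation.Binary.Bundles using (Setoid)
open import Relation.Binary.PropositionalEquality
  using (_≡_; refl; sym; trans; cong; cong₂; subst; module ≡-Reasoning)
open import Relation.Nullary using (¬_; contradiction)
import Relation.Binary.Reasoning.Setoid as SetoidReasoning

-- Unsigned divisibility is stated on ∣ i ∣, so Agda cannot infer i from a
-- proof of m ∣ i.  The integers are therefore explicit here, as are the group
-- elements in the lemmas about Dic._≈_, which unfolds to such a divisibility.
module _ (m : ℤ) where

  ∣m⇒∣-m : ∀ i → m ∣ i → m ∣ - i
  ∣m⇒∣-m i = subst (ℕ._∣_ _) (sym (∣-i∣≡∣i∣ i))

  ∣m∣n⇒∣m+n : ∀ i j → m ∣ i → m ∣ j → m ∣ i + j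
  ∣m∣n⇒∣m+n i j m∣i m∣j =
    Signed.∣⇒∣ᵤ (Signed.∣m∣n⇒∣m+n (Signed.∣ᵤ⇒∣ {m} {i} m∣i) (Signed.∣ᵤ⇒∣ {m} {j} m∣j))

  ∣-resp-≡ : ∀ {i j} → i ≡ j → m ∣ j → m ∣ i
  ∣-resp-≡ refl m∣j = m∣j

%ℕ-≡⇒∣- : ∀ (d : ℕ) .{{_ : NonZero d}} k l → k %ℕ d ≡ l %ℕ d → + d ∣ k - l
%ℕ-≡⇒∣- d k l k≡l = Signed.∣⇒∣ᵤ (Signed.divides (k /ℕ d - l /ℕ d) (begin
  k - l
    ≡⟨ cong₂ _-_ (a≡a%ℕn+[a/ℕn]*n k d) (a≡a%ℕn+[a/ℕn]*n l d) ⟩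
  (+ (k %ℕ d) + k /ℕ d * + d) - (+ (l %ℕ d) + l /ℕ d * + d)
    ≡⟨ cong (λ r → (+ r + k /ℕ d * + d) - (+ (l %ℕ d) + l /ℕ d * + d)) k≡l ⟩
  (+ (l %ℕ d) + k /ℕ d * + d) - (+ (l %ℕ d) + l /ℕ d * + d)
    ≡⟨ multiples-differ (+ (l %ℕ d)) (k /ℕ d) (l /ℕ d) (+ d) ⟩
  (k /ℕ d - l /ℕ d) * + d ∎))
  where
  open ≡-Reasoning
  multiples-differ : ∀ r p q d → (r + p * d) - (r + q * d) ≡ (p - q) * d
  multiples-differ = ℤ-Solver.solve-∀

module _ {c ℓ} (S : Setoid c ℓ) where
  open Setoid S using (Carrier; _≈_) renaming (sym to ≈-sym)
  open SetoidUnique S using (Unique; _∷_)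

  Unique-lookup-injective : ∀ {xs} → Unique xs → ∀ i j → lookup xs i ≈ lookup xs j → i ≡ j
  Unique-lookup-injective (_ ∷ _) zero zero _ = refl
  Unique-lookup-injective (x≉xs ∷ _) zero (suc j) x≈ =
    contradiction x≈ (All.lookup x≉xs (∈-lookup j))
  Unique-lookup-injective (x≉xs ∷ _) (suc i) zero ≈x =
    contradiction (≈-sym ≈x) (All.lookup x≉xs (∈-lookup i))
  Unique-lookup-injective (_ ∷ xs!) (suc i) (suc j) eq = cong suc (Unique-lookup-injective xs! i j eq)

  Unique-length≤ : ∀ {b} (f : Carrier → Fin b) → Injective _≈_ _≡_ f →
                   ∀ {xs} → Unique xs → length xs ≤ b
  Unique-length≤ f f-injective xs! =
    injective⇒≤ (λ eq → Unique-lookup-injective xs! _ _ (f-injective eq))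

module DicProperties (n : ℕ) where
  open Dic n

  2n : ℤ
  2n = + (2 *ℕ n)

  ≈-refl : ∀ g → g ≈ g
  ≈-refl (k , _) = refl , ∣-resp-≡ 2n (+-inverseʳ k) (_ ℕ.∣0)

  ≈-sym : ∀ g h → g ≈ h → h ≈ g
  ≈-sym (k , _) (l , _) (refl , d) = refl , subst (ℕ._∣_ (2 *ℕ n)) (∣i-j∣≡∣j-i∣ k l) d

  ≈-trans : ∀ g h w → g ≈ h → h ≈ w → g ≈ w
  ≈-trans (k , _) (l , _) (m , _) (refl , d) (refl , d′) =
    refl , ∣-resp-≡ 2n (sym (+-minus-telescope k l m)) (∣m∣n⇒∣m+n 2n (k - l) (l - m) d d′)

  ≈-setoid : Setoid 0ℓ 0ℓ
  ≈-setoid = record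
    { Carrier = Elt
    ; _≈_ = _≈_
    ; isEquivalence = record
      { refl  = λ {g} → ≈-refl g
      ; sym   = λ {g} {h} → ≈-sym g h
      ; trans = λ {g} {h} {w} → ≈-trans g h w
      }
    }

  partner : Elt → Elt
  partner (k , j) = (k , not j)

  partner-cong : ∀ g h → g ≈ h → partner g ≈ partner h
  partner-cong _ _ (refl , d) = refl , d

  partner-involutive : ∀ g → partner (partner g) ≡ g
  partner-involutive (k , j) = cong (k ,_) (not-involutive j)

  partner-≉ : ∀ g → ¬ partner g ≈ g
  partner-≉ (k , j) (j≡not , _) = not-¬ refl (sym j≡not)

  2n∣n+n : 2n ∣ + n + + n
  2n∣n+n = ∣-resp-≡ 2n (sym 2n≡n+n) (ℕ.∣-refl)
    where
    2n≡n+n : 2n ≡ + n + + n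
    2n≡n+n = trans (cong (λ r → + (n +ℕ r)) (+-identityʳ n)) (pos-+ n n)

  ·-inverse-cancel : ∀ u t s → s ≈ inv t → ((u · t) · s) ≈ u
  ·-inverse-cancel (k , false) (l , false) (m , false) (refl , d) =
    refl , ∣-resp-≡ 2n (difference k l m) d
    where
    difference : ∀ k l m → k + l + 0ℤ + m + 0ℤ - k ≡ m - - l
    difference = ℤ-Solver.solve-∀
  ·-inverse-cancel (k , true) (l , false) (m , false) (refl , d) =
    refl , ∣-resp-≡ 2n (difference k l m) (∣m⇒∣-m 2n (m - - l) d)
    where
    difference : ∀ k l m → k + - l + 0ℤ + - m + 0ℤ - k ≡ - (m - - l)
    difference = ℤ-Solver.solve-∀
  ·-inverse-cancel (k , false) (l , true) (m , true) (refl , d) =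
    refl , ∣-resp-≡ 2n (difference k l m (+ n)) (∣m⇒∣-m 2n (m - (l + + n)) d)
    where
    difference : ∀ k l m N → k + l + 0ℤ + - m + N - k ≡ - (m - (l + N))
    difference = ℤ-Solver.solve-∀
  ·-inverse-cancel (k , true) (l , true) (m , true) (refl , d) =
    refl , ∣-resp-≡ 2n (difference k l m (+ n))
                        (∣m∣n⇒∣m+n 2n (m - (l + + n)) (+ n + + n) d 2n∣n+n)
    where
    difference : ∀ k l m N → k + - l + N + m + 0ℤ - k ≡ (m - (l + N)) + (N + N)
    difference = ℤ-Solver.solve-∀

module Strategy (n : ℕ) .{{_ : NonZero n}} where
  open RAVDic n
  open DicProperties n
  open SetoidMembership ≈-setoid using (_∈_; _∉_)
  open SetoidMembershipProperties using (∈-resp-≈; ∉⇒All[≉])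
  open SetoidUnique ≈-setoid using (Unique; []; _∷_)

  private instance
    2n-nonZero : NonZero (2 *ℕ n)
    2n-nonZero = m*n≢0 2 n

  order : ℕ
  order = 2 *ℕ n +ℕ 2 *ℕ n

  residue : ℤ → Fin (2 *ℕ n)
  residue k = fromℕ< (n%ℕd<d k (2 *ℕ n))

  tag : Elt → Fin (2 *ℕ n) ⊎ Fin (2 *ℕ n)
  tag (k , false) = inj₁ (residue k)
  tag (k , true)  = inj₂ (residue k)

  index : Elt → Fin order
  index g = join (2 *ℕ n) (2 *ℕ n) (tag g)

  residue-≡⇒∣ : ∀ k l → residue k ≡ residue l → 2n ∣ k - l
  residue-≡⇒∣ k l eq = %ℕ-≡⇒∣- (2 *ℕ n) k l (fromℕ<-injective _ _ _ _ eq)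

  tag-injective : Injective _≈_ _≡_ tag
  tag-injective {k , false} {l , false} eq = refl , residue-≡⇒∣ k l (inj₁-injective eq)
  tag-injective {k , true}  {l , true}  eq = refl , residue-≡⇒∣ k l (inj₂-injective eq)
  tag-injective {_ , false} {_ , true}  ()
  tag-injective {_ , true}  {_ , false} ()

  index-injective : Injective _≈_ _≡_ index
  index-injective {g} {h} eq = tag-injective (begin
    tag g                       ≡⟨ splitAt-join (2 *ℕ n) (2 *ℕ n) (tag g) ⟨
    splitAt (2 *ℕ n) (index g)  ≡⟨ cong (splitAt (2 *ℕ n)) eq ⟩
    splitAt (2 *ℕ n) (index h)  ≡⟨ splitAt-join (2 *ℕ n) (2 *ℕ n) (tag h) ⟩
    tag h                       ∎)
    where open ≡-Reasoning

  Unique-length≤order : ∀ {gs} → Unique gs → length gs ≤ order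
  Unique-length≤order = Unique-length≤ ≈-setoid index index-injective

  partnerMove : Elt → Move
  partnerMove (_ , false) = (b , neg)
  partnerMove (_ , true)  = (b , pos)

  respond : Elt → Elt
  respond g = g · moveElt (partnerMove g)

  respond≈partner : ∀ g → respond g ≈ partner g
  respond≈partner (k , false) = refl , ∣-resp-≡ 2n (difference k (+ n)) 2n∣n+n
    where
    difference : ∀ k N → k + (0ℤ + N + N) + 0ℤ - k ≡ N + N
    difference = ℤ-Solver.solve-∀
  respond≈partner (k , true) = refl , ∣-resp-≡ 2n (difference k (+ n)) (_ ℕ.∣0)
    where
    difference : ∀ k N → k + - (0ℤ + N) + N - k ≡ 0ℤ
    difference = ℤ-Solver.solve-∀

  ∈-resp : ∀ {gs} g h → g ≈ h → g ∈ gs → h ∈ gs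
  ∈-resp g h = ∈-resp-≈ ≈-setoid {_} {g} {h}

  value∈visited : ∀ h → value h ∈ visited h
  value∈visited []      = here (≈-refl e)
  value∈visited (t ∷ h) = here (≈-refl (value (t ∷ h)))

  fresh⇒legal : ∀ h t s → Fresh (t ∷ h) s → Legal (t ∷ h) s
  fresh⇒legal h t s fresh s≈t⁻¹ =
    fresh (there (∈-resp (value h) (value (s ∷ t ∷ h)) backtracked (value∈visited h)))
    where
    backtracked : value h ≈ value (s ∷ t ∷ h)
    backtracked = ≈-sym (value (s ∷ t ∷ h)) (value h)
                        (·-inverse-cancel (value h) (moveElt t) (moveElt s) s≈t⁻¹)

  PartnerClosed : List Elt → Set
  PartnerClosed gs = ∀ g → g ∈ gs → partner g ∈ gs

  Paired : List Elt → Set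
  Paired gs = PartnerClosed gs × Unique gs

  respond-fresh : ∀ {g gs} → PartnerClosed gs → g ∉ gs → respond g ∉ g ∷ gs
  respond-fresh {g} closed g∉gs (here r≈g) = partner-≉ g (begin
    partner g  ≈⟨ respond≈partner g ⟨
    respond g  ≈⟨ r≈g ⟩
    g          ∎)
    where open SetoidReasoning ≈-setoid
  respond-fresh {g} {gs} closed g∉gs (there r∈gs) =
    g∉gs (subst (_∈ gs) (partner-involutive g)
                (closed (partner g) (∈-resp (respond g) (partner g) (respond≈partner g) r∈gs)))

  respond-closed : ∀ {g gs} → PartnerClosed gs → PartnerClosed (respond g ∷ g ∷ gs)
  respond-closed {g} closed q (here q≈r) = there (here (begin
    partner q
      ≈⟨ partner-cong q (partner g) (≈-trans q (respond g) (partner g) q≈r (respond≈partner g)) ⟩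
    partner (partner g)
      ≡⟨ partner-involutive g ⟩
    g ∎))
    where open SetoidReasoning ≈-setoid
  respond-closed {g} closed q (there (here q≈g)) = here (begin
    partner q  ≈⟨ partner-cong q g q≈g ⟩
    partner g  ≈⟨ respond≈partner g ⟨
    respond g  ∎)
    where open SetoidReasoning ≈-setoid
  respond-closed closed q (there (there q∈gs)) = there (there (closed q q∈gs))

  Unique-∷ : ∀ g {gs} → g ∉ gs → Unique gs → Unique (g ∷ gs)
  Unique-∷ g g∉gs gs! = ∉⇒All[≉] ≈-setoid {g} g∉gs ∷ gs!

  Paired-respond : ∀ {g gs} → Paired gs → g ∉ gs →
                   respond g ∉ g ∷ gs × Paired (respond g ∷ g ∷ gs)
  Paired-respond {g} {gs} (closed , gs!) g∉gs =
    let r∉ = respond-fresh closed g∉gs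
    in r∉ , respond-closed closed , Unique-∷ (respond g) r∉ (Unique-∷ g g∉gs gs!)

  player2Loses : ∀ f h → Paired (visited h) →
                 order ≤ f +ℕ f +ℕ length (visited h) → Lose h
  player2Loses zero h (_ , visited!) bound = lose λ t _ t-fresh →
    contradiction bound (<⇒≱ (Unique-length≤order (Unique-∷ (value (t ∷ h)) t-fresh visited!)))
  player2Loses (suc f) h paired bound = lose λ t _ t-fresh →
    let (r-fresh , paired′) = Paired-respond paired t-fresh
        s = partnerMove (value (t ∷ h))
    in win s (fresh⇒legal h t s r-fresh) r-fresh
           (player2Loses f (s ∷ t ∷ h) paired′ (subst (order ≤_) (two-more f (length (visited h))) bound))
    where
    two-more : ∀ f l → suc f +ℕ suc f +ℕ l ≡ f +ℕ f +ℕ suc (suc l)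
    two-more = ℕ-Solver.solve-∀

  player1Wins : Player1Wins
  player1Wins =
    let (e-fresh , paired) = Paired-respond {e} {[]} ((λ _ ()) , []) (λ ())
    in win (partnerMove e) tt e-fresh (player2Loses (2 *ℕ n) _ paired (m≤m+n _ 2))

theorem4p2 : (n : ℕ) → 2 ≤ n → RAVDic.Player1Wins n
theorem4p2 (suc n) _ = Strategy.player1Wins (suc n)
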